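{- Let $m\ge3$ be an odd integer, $\mathbf{a}=[1+2i:0\le i<m]$ and $\mathbf{b}=[2im:0\le i<m]$. Then $\langle\mathbf{a},\mathbf{b}\rangle$ is admissible. Moreover, if any number of entries $b_i$ of $\mathbf{b}$ with $i\neq0$ are replaced by $b_i'=-b_i-2m$, the resulting pair $\langle\mathbf{a},\mathbf{b}'\rangle$ is admissible. Similarly, if any number of entries $a_i$ of $\mathbf{a}$ with $i\ne0$ are replaced by $a_i'=-a_i-2(m-1)m$, the resulting pair $\langle\mathbf{a}',\mathbf{b}\rangle$ is admissible.
   Context: $\mathcal{N}_N=\{1-N,3-N,\ldots,N-1\}$. For odd $m\ge3$, a pair $\langle[a_0,\ldots,a_{m-1}],[b_0,\ldots,b_{m-1}]\rangle$ of integer sequences is admissible if all $a_i$ are odd integers in $\{1-2m^2,\ldots,2m^2-1\}$, all $b_i$ are even integers in $\{ -2m^2,\ldots,2m^2-2\}$, $a_0=1$, $b_0=0$, and $\{x(a_i+b_j):x\in\{ -1,1\},0\le i,j<m\}=\mathcal{N}_{2m^2}$. -}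

module Defs where

open import Data.Nat as ℕ using (ℕ)
open import Data.Integer
open import Data.Fin using (Fin; toℕ)
open import Data.Bool using (Bool; true; false; if_then_else_)
open import Data.Product using (Σ; ∃; _×_)
open import Data.Sum using (_⊎_)
open import Function.Bundles using (_⇔_)
open import Relation.Binary.PropositionalEquality using (_≡_)

Even : ℤ → Set
Even z = ∃ λ (k : ℤ) → z ≡ + 2 * k

Odd : ℤ → Set
Odd z = ∃ λ (k : ℤ) → z ≡ + 2 * k + + 1

In𝒩 : ℕ → ℤ → Set
In𝒩 N z = Σ ℕ λ k → (k ℕ.< N) × (z ≡ (+ 1 - + N) + + (2 ℕ.* k))

InSums : (m : ℕ) → (Fin m → ℤ) → (Fin m → ℤ) → ℤ → Set
InSums m a b z = Σ ℤ λ x → ((x ≡ + 1) ⊎ (x ≡ -1ℤ)) ×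
                 Σ (Fin m) λ i → Σ (Fin m) λ j → z ≡ x * (a i + b j)

Admissible : (m : ℕ) → (Fin m → ℤ) → (Fin m → ℤ) → Set
Admissible m a b =
  let M = 2 ℕ.* m ℕ.* m in
  (∀ i → Odd (a i) × (+ 1 - + M ≤ a i) × (a i ≤ + M - + 1)) ×
  (∀ i → Even (b i) × (- + M ≤ b i) × (b i ≤ + M - + 2)) ×
  (∀ i → toℕ i ≡ 0 → a i ≡ + 1) ×
  (∀ i → toℕ i ≡ 0 → b i ≡ + 0) ×
  (∀ z → InSums m a b z ⇔ In𝒩 M z)

seqA : (m : ℕ) → Fin m → ℤ
seqA m i = + 1 + + (2 ℕ.* toℕ i)

seqB : (m : ℕ) → Fin m → ℤ
seqB m i = + (2 ℕ.* toℕ i ℕ.* m)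

replaceB : (m : ℕ) → (Fin m → Bool) → (Fin m → ℤ) → Fin m → ℤ
replaceB m s b i = if s i then - b i - + (2 ℕ.* m) else b i

replaceA : (m : ℕ) → (Fin m → Bool) → (Fin m → ℤ) → Fin m → ℤ
replaceA m s a i = if s i then - a i - + (2 ℕ.* (m ℕ.∸ 1) ℕ.* m) else a i

{-# OPTIONS --safe #-}
-- With a_i = 1 + 2i and b_j = 2jm the sums a_i + b_j = 2(i + jm) + 1 run through the odd numbers
-- 1, 3, …, 2m² − 1 exactly once, and 𝒩_{2m²} consists of these numbers and their negatives.
-- Since a_i + a_{m−1−i} = 2m, replacing b_j by b′_j = −b_j − 2m gives a_i + b′_j = −(a_{m−1−i} + b_j)
-- and a_i + b_j = −(a_{m−1−i} + b′_j); symmetrically b_j + b_{m−1−j} = 2(m−1)m handles the replaced a_i.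
-- So the new sums agree with the old ones up to sign, and the set of signed sums is still 𝒩_{2m²}.
-- Parity and range of the entries follow because a_i = a_i + b_0 and b_j + 1 = a_0 + b_j lie in 𝒩_{2m²}.
module Submission where

open import Defs
open import Data.Bool using (Bool; true; false; if_then_else_)
open import Data.Bool.Properties using (if-cong)
open import Data.Fin using (Fin; toℕ; zero; opposite; combine; fromℕ<)
open import Data.Fin.Properties using (toℕ<n; toℕ-fromℕ<; toℕ-combine; combine-surjective; opposite-prop)
open import Data.Product using (Σ; ∃; _×_; _,_; proj₁; proj₂)
open import Data.Sum using (_⊎_; inj₁; inj₂)
open import Function.Bundles using (_⇔_; mk⇔; Equivalence)
open import Function.Properties.Equivalence using () renaming (trans to ⇔-trans; sym to ⇔-sym)
open import Relation.Binary.PropositionalEquality using (_≡_; refl; sym; trans; cong; subst; module ≡-Reasoning)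
open import Relation.Nullary using (yes; no)
open import Data.Nat as ℕ using (ℕ; suc; s≤s)
import Data.Nat.Properties as ℕ
import Data.Nat.Tactic.RingSolver as ℕ

-- The ℤ operators are opened only in here: the statement of lemma3p7 uses the ℕ ones unqualified.
module AdmissiblePairs where

  open import Data.Integer using (ℤ; +_; -_; -1ℤ; _+_; _-_; _*_; _≤_)
  open import Data.Integer.Properties
    using (pos-*; +-comm; +-identityʳ; *-assoc; *-identityˡ; -1*i≡-i; +-monoˡ-≤; i≤i+j; i-j≤i; module ≤-Reasoning)
  open import Data.Integer.Tactic.RingSolver using (solve-∀)

  Sign : ℤ → Set
  Sign x = x ≡ + 1 ⊎ x ≡ -1ℤ

  Sign-* : ∀ {x y} → Sign x → Sign y → Sign (x * y)
  Sign-* (inj₁ refl) (inj₁ refl) = inj₁ refl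
  Sign-* (inj₁ refl) (inj₂ refl) = inj₂ refl
  Sign-* (inj₂ refl) (inj₁ refl) = inj₂ refl
  Sign-* (inj₂ refl) (inj₂ refl) = inj₁ refl

  SignedOdd : ℕ → ℤ → Set
  SignedOdd n z = Σ ℤ λ x → Sign x × Σ ℕ λ k → k ℕ.< n × z ≡ x * (+ 2 * + k + + 1)

  In𝒩-elem : ∀ n k → + 1 - + (n ℕ.+ n) + + (2 ℕ.* k) ≡ + 2 * (+ k - + n) + + 1
  In𝒩-elem n k = trans (cong (λ t → + 1 - + (n ℕ.+ n) + t) (pos-* 2 k)) (identity (+ n) (+ k))
    where
    identity : ∀ N K → + 1 - (N + N) + + 2 * K ≡ + 2 * (K - N) + + 1
    identity = solve-∀

  In𝒩-upper : ∀ n r → + 1 - + (n ℕ.+ n) + + (2 ℕ.* (n ℕ.+ r)) ≡ + 2 * + r + + 1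
  In𝒩-upper n r = trans (In𝒩-elem n (n ℕ.+ r)) (identity (+ n) (+ r))
    where
    identity : ∀ N R → + 2 * (N + R - N) + + 1 ≡ + 2 * R + + 1
    identity = solve-∀

  In𝒩-lower : ∀ {n} k d → suc (k ℕ.+ d) ≡ n → + 1 - + (n ℕ.+ n) + + (2 ℕ.* k) ≡ - (+ 2 * + d + + 1)
  In𝒩-lower k d refl = trans (In𝒩-elem (suc (k ℕ.+ d)) k) (identity (+ k) (+ d))
    where
    identity : ∀ K D → + 2 * (K - (+ 1 + K + D)) + + 1 ≡ - (+ 2 * D + + 1)
    identity = solve-∀

  In𝒩⇒SignedOdd : ∀ n {z} → In𝒩 (n ℕ.+ n) z → SignedOdd n z
  In𝒩⇒SignedOdd n (k , k<2n , refl) with n ℕ.≤? k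
  ... | yes n≤k with ℕ.m≤n⇒∃[o]m+o≡n n≤k
  ...   | r , refl = + 1 , inj₁ refl , r , ℕ.+-cancelˡ-< n r n k<2n ,
                     trans (In𝒩-upper n r) (sym (*-identityˡ _))
  In𝒩⇒SignedOdd n (k , k<2n , refl) | no n≰k with ℕ.m≤n⇒∃[o]m+o≡n (ℕ.≰⇒> n≰k)
  ...   | d , refl = -1ℤ , inj₂ refl , d , s≤s (ℕ.m≤n+m d k) ,
                     trans (In𝒩-lower k d refl) (sym (-1*i≡-i _))

  SignedOdd⇒In𝒩 : ∀ n {z} → SignedOdd n z → In𝒩 (n ℕ.+ n) z
  SignedOdd⇒In𝒩 n (_ , inj₁ refl , r , r<n , refl) =
    n ℕ.+ r , ℕ.+-monoʳ-< n r<n , trans (*-identityˡ _) (sym (In𝒩-upper n r))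
  SignedOdd⇒In𝒩 n (_ , inj₂ refl , r , r<n , refl) with ℕ.m≤n⇒∃[o]m+o≡n r<n
  ... | d , refl = d , ℕ.<-≤-trans (s≤s (ℕ.m≤n+m d r)) (ℕ.m≤m+n _ _) ,
                   trans (-1*i≡-i _) (sym (In𝒩-lower d r (cong suc (ℕ.+-comm d r))))

  In𝒩⇔SignedOdd : ∀ n z → In𝒩 (n ℕ.+ n) z ⇔ SignedOdd n z
  In𝒩⇔SignedOdd n z = mk⇔ (In𝒩⇒SignedOdd n) (SignedOdd⇒In𝒩 n)

  In𝒩⇒Odd : ∀ n {z} → In𝒩 (n ℕ.+ n) z → Odd z
  In𝒩⇒Odd n (k , _ , refl) = + k - + n , In𝒩-elem n k

  In𝒩-bounds : ∀ N {z} → In𝒩 N z → + 1 - + N ≤ z × z ≤ + N - + 1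
  In𝒩-bounds N (k , k<N , refl) with ℕ.m≤n⇒∃[o]m+o≡n k<N
  ... | d , refl = i≤i+j _ _ , (begin
    + 1 - + (suc k ℕ.+ d) + + (2 ℕ.* k)  ≡⟨ z≡N-1-2d ⟩
    + (suc k ℕ.+ d) - + 1 - + (2 ℕ.* d)  ≤⟨ i-j≤i _ (+ (2 ℕ.* d)) ⟩
    + (suc k ℕ.+ d) - + 1                ∎)
    where
    open ≤-Reasoning
    identity : ∀ K D → + 1 - (+ 1 + K + D) + + 2 * K ≡ + 1 + K + D - + 1 - + 2 * D
    identity = solve-∀
    z≡N-1-2d : + 1 - + (suc k ℕ.+ d) + + (2 ℕ.* k) ≡ + (suc k ℕ.+ d) - + 1 - + (2 ℕ.* d)
    z≡N-1-2d = trans (cong (λ t → + 1 - + (suc k ℕ.+ d) + t) (pos-* 2 k))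
                 (trans (identity (+ k) (+ d)) (cong (λ t → + (suc k ℕ.+ d) - + 1 - t) (sym (pos-* 2 d))))

  Odd⇒Even-pred : ∀ {z} → Odd z → Even (z - + 1)
  Odd⇒Even-pred (k , refl) = k , identity k
    where
    identity : ∀ K → + 2 * K + + 1 - + 1 ≡ + 2 * K
    identity = solve-∀

  pred-bounds : ∀ N {z} → + 1 - + N ≤ z × z ≤ + N - + 1 → - + N ≤ z - + 1 × z - + 1 ≤ + N - + 2
  pred-bounds N {z} (lower , upper) =
    subst (_≤ z - + 1) (identity₁ (+ N)) (+-monoˡ-≤ (- + 1) lower) ,
    subst (z - + 1 ≤_) (identity₂ (+ N)) (+-monoˡ-≤ (- + 1) upper)
    where
    identity₁ : ∀ M → + 1 - M - + 1 ≡ - M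
    identity₁ = solve-∀
    identity₂ : ∀ M → M - + 1 - + 1 ≡ M - + 2
    identity₂ = solve-∀

  InSums-sign : ∀ {m a b x z} → Sign x → InSums m a b z → InSums m a b (x * z)
  InSums-sign {x = x} sx (y , sy , i , j , refl) = x * y , Sign-* sx sy , i , j , sym (*-assoc x y _)

  InSums-⊆ : ∀ {m} {a b a′ b′ : Fin m → ℤ} → (∀ i j → InSums m a′ b′ (a i + b j)) →
             ∀ {z} → InSums m a b z → InSums m a′ b′ z
  InSums-⊆ {a′ = a′} {b′} sums (x , sx , i , j , refl) = InSums-sign {a = a′} {b′} sx (sums i j)

  InSums-⇔ : ∀ {m} (a b a′ b′ : Fin m → ℤ) → (∀ i j → InSums m a′ b′ (a i + b j)) →
             (∀ i j → InSums m a b (a′ i + b′ j)) → ∀ z → InSums m a b z ⇔ InSums m a′ b′ z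
  InSums-⇔ a b a′ b′ to from z = mk⇔ (InSums-⊆ {a = a} {b} {a′} {b′} to) (InSums-⊆ {a = a′} {b′} {a} {b} from)

  sum∈InSums : ∀ {m} a b i j → InSums m a b (a i + b j)
  sum∈InSums a b i j = + 1 , inj₁ refl , i , j , sym (*-identityˡ _)

  -sum∈InSums : ∀ {m} a b i j → InSums m a b (- (a i + b j))
  -sum∈InSums a b i j = -1ℤ , inj₂ refl , i , j , sym (-1*i≡-i _)

  InSums-swap : ∀ {m} a b {z} → InSums m a b z → InSums m b a z
  InSums-swap a b (x , sx , i , j , refl) = x , sx , j , i , cong (x *_) (+-comm (a i) (b j))

  InSums-comm : ∀ {m} a b z → InSums m a b z ⇔ InSums m b a z
  InSums-comm a b z = mk⇔ (InSums-swap a b) (InSums-swap b a)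

  reflected-sums : ∀ a a′ b {b′ c} → a + a′ ≡ c → b′ ≡ - b - c → a + b′ ≡ - (a′ + b) × a + b ≡ - (a′ + b′)
  reflected-sums a a′ b refl refl = identity₁ a a′ b , identity₂ a a′ b
    where
    identity₁ : ∀ A A′ B → A + (- B - (A + A′)) ≡ - (A′ + B)
    identity₁ = solve-∀
    identity₂ : ∀ A A′ B → A + B ≡ - (A′ + (- B - (A + A′)))
    identity₂ = solve-∀

  InSums-reflectʳ : ∀ {m c} {a b b′ : Fin m → ℤ} (σ : Fin m → Fin m) → (∀ i → a i + a (σ i) ≡ c) →
                    (∀ j → b′ j ≡ b j ⊎ b′ j ≡ - b j - c) → ∀ z → InSums m a b′ z ⇔ InSums m a b z
  InSums-reflectʳ {a = a} {b} {b′} σ pairs b′-cases =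
    InSums-⇔ a b′ a b (λ i j → proj₁ (sums i j)) (λ i j → proj₂ (sums i j))
    where
    sums : ∀ i j → InSums _ a b (a i + b′ j) × InSums _ a b′ (a i + b j)
    sums i j with b′-cases j
    ... | inj₁ same = subst (InSums _ a b) (cong (_+_ (a i)) (sym same)) (sum∈InSums a b i j) ,
                      subst (InSums _ a b′) (cong (_+_ (a i)) same) (sum∈InSums a b′ i j)
    ... | inj₂ reflected with reflected-sums (a i) (a (σ i)) (b j) (pairs i) reflected
    ...   | eq , eq′ = subst (InSums _ a b) (sym eq) (-sum∈InSums a b (σ i) j) ,
                       subst (InSums _ a b′) (sym eq′) (-sum∈InSums a b′ (σ i) j)

  InSums-reflectˡ : ∀ {m c} {a a′ b : Fin m → ℤ} (σ : Fin m → Fin m) → (∀ j → b j + b (σ j) ≡ c) →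
                    (∀ i → a′ i ≡ a i ⊎ a′ i ≡ - a i - c) → ∀ z → InSums m a′ b z ⇔ InSums m a b z
  InSums-reflectˡ {a = a} {a′} {b} σ pairs a′-cases z =
    ⇔-trans (InSums-comm a′ b z) (⇔-trans (InSums-reflectʳ {a = b} {a} {a′} σ pairs a′-cases z) (InSums-comm b a z))

  2*m*m≡m*m+m*m : ∀ m → 2 ℕ.* m ℕ.* m ≡ m ℕ.* m ℕ.+ m ℕ.* m
  2*m*m≡m*m+m*m = ℕ.solve-∀

  sums⇒Admissible : ∀ {n} {a b : Fin (suc n) → ℤ} → (∀ i → toℕ i ≡ 0 → a i ≡ + 1) → (∀ j → toℕ j ≡ 0 → b j ≡ + 0) →
                    (∀ z → InSums (suc n) a b z ⇔ In𝒩 (2 ℕ.* suc n ℕ.* suc n) z) → Admissible (suc n) a b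
  sums⇒Admissible {n} {a} {b} a₀ b₀ sums = a-odd , b-even , a₀ , b₀ , sums
    where
    m M : ℕ
    m = suc n
    M = 2 ℕ.* m ℕ.* m

    odd-bounded : ∀ {y} → InSums m a b y → Odd y × + 1 - + M ≤ y × y ≤ + M - + 1
    odd-bounded {y} y∈sums = In𝒩⇒Odd (m ℕ.* m) (subst (λ N → In𝒩 N y) (2*m*m≡m*m+m*m m) y∈𝒩) , In𝒩-bounds M y∈𝒩
      where
      y∈𝒩 : In𝒩 M y
      y∈𝒩 = Equivalence.to (sums y) y∈sums

    a-odd : ∀ i → Odd (a i) × + 1 - + M ≤ a i × a i ≤ + M - + 1
    a-odd i = odd-bounded (subst (InSums m a b) a+b₀≡a (sum∈InSums a b i zero))
      where
      a+b₀≡a : a i + b zero ≡ a i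
      a+b₀≡a = trans (cong (_+_ (a i)) (b₀ zero refl)) (+-identityʳ (a i))

    b-even : ∀ j → Even (b j) × - + M ≤ b j × b j ≤ + M - + 2
    b-even j with odd-bounded (sum∈InSums a b zero j)
    ... | y-odd , y-bounds =
      subst (λ w → Even w × - + M ≤ w × w ≤ + M - + 2) (sym b≡a₀+b-1) (Odd⇒Even-pred y-odd , pred-bounds M y-bounds)
      where
      identity : ∀ B → B ≡ + 1 + B - + 1
      identity = solve-∀
      b≡a₀+b-1 : b j ≡ a zero + b j - + 1
      b≡a₀+b-1 = trans (identity (b j)) (cong (λ t → t + b j - + 1) (sym (a₀ zero refl)))

  toℕ+toℕ-opposite : ∀ {n} (i : Fin n) → suc (toℕ i ℕ.+ toℕ (opposite i)) ≡ n
  toℕ+toℕ-opposite i = trans (cong (λ t → suc (toℕ i ℕ.+ t)) (opposite-prop i)) (ℕ.m+[n∸m]≡n (toℕ<n i))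

  seqA-opposite : ∀ m i → seqA m i + seqA m (opposite i) ≡ + (2 ℕ.* m)
  seqA-opposite m i = cong +_ (trans (identity (toℕ i) (toℕ (opposite i))) (cong (2 ℕ.*_) (toℕ+toℕ-opposite i)))
    where
    identity : ∀ i i′ → 1 ℕ.+ 2 ℕ.* i ℕ.+ (1 ℕ.+ 2 ℕ.* i′) ≡ 2 ℕ.* suc (i ℕ.+ i′)
    identity = ℕ.solve-∀

  seqB-opposite : ∀ m j → seqB m j + seqB m (opposite j) ≡ + (2 ℕ.* (m ℕ.∸ 1) ℕ.* m)
  seqB-opposite m j = cong +_ (trans (identity (toℕ j) (toℕ (opposite j)) m)
                                      (cong (λ t → 2 ℕ.* t ℕ.* m) (cong ℕ.pred (toℕ+toℕ-opposite j))))
    where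
    identity : ∀ j j′ m → 2 ℕ.* j ℕ.* m ℕ.+ 2 ℕ.* j′ ℕ.* m ≡ 2 ℕ.* (j ℕ.+ j′) ℕ.* m
    identity = ℕ.solve-∀

  seqA+seqB : ∀ m i j → seqA m i + seqB m j ≡ + 2 * + toℕ (combine j i) + + 1
  seqA+seqB m i j = begin
    + (1 ℕ.+ 2 ℕ.* toℕ i ℕ.+ 2 ℕ.* toℕ j ℕ.* m)     ≡⟨ cong +_ (identity (toℕ i) (toℕ j) m) ⟩
    + (2 ℕ.* (m ℕ.* toℕ j ℕ.+ toℕ i) ℕ.+ 1)         ≡⟨ cong (λ t → + (2 ℕ.* t ℕ.+ 1)) (toℕ-combine j i) ⟨
    + (2 ℕ.* toℕ (combine j i)) + + 1                ≡⟨ cong (_+ + 1) (pos-* 2 (toℕ (combine j i))) ⟩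
    + 2 * + toℕ (combine j i) + + 1                  ∎
    where
    open ≡-Reasoning
    identity : ∀ i j m → 1 ℕ.+ 2 ℕ.* i ℕ.+ 2 ℕ.* j ℕ.* m ≡ 2 ℕ.* (m ℕ.* j ℕ.+ i) ℕ.+ 1
    identity = ℕ.solve-∀

  InSums-seq⇔SignedOdd : ∀ m z → InSums m (seqA m) (seqB m) z ⇔ SignedOdd (m ℕ.* m) z
  InSums-seq⇔SignedOdd m z = mk⇔ to from
    where
    to : InSums m (seqA m) (seqB m) z → SignedOdd (m ℕ.* m) z
    to (x , sx , i , j , refl) = x , sx , toℕ (combine j i) , toℕ<n (combine j i) , cong (x *_) (seqA+seqB m i j)
    from : SignedOdd (m ℕ.* m) z → InSums m (seqA m) (seqB m) z
    from (x , sx , k , k<m*m , refl) with combine-surjective {m} {m} (fromℕ< k<m*m)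
    ... | j , i , combine≡k = x , sx , i , j ,
      trans (cong (λ t → x * (+ 2 * + t + + 1)) (sym toℕ-combine≡k)) (cong (x *_) (sym (seqA+seqB m i j)))
      where
      toℕ-combine≡k : toℕ (combine j i) ≡ k
      toℕ-combine≡k = trans (cong toℕ combine≡k) (toℕ-fromℕ< k<m*m)

  InSums-seq⇔In𝒩 : ∀ m z → InSums m (seqA m) (seqB m) z ⇔ In𝒩 (2 ℕ.* m ℕ.* m) z
  InSums-seq⇔In𝒩 m z rewrite 2*m*m≡m*m+m*m m =
    ⇔-trans (InSums-seq⇔SignedOdd m z) (⇔-sym (In𝒩⇔SignedOdd (m ℕ.* m) z))

  if-either : ∀ {A : Set} (t : Bool) {x y : A} → (if t then x else y) ≡ y ⊎ (if t then x else y) ≡ x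
  if-either true  = inj₂ refl
  if-either false = inj₁ refl

  replaceB-sums : ∀ m s z → InSums m (seqA m) (replaceB m s (seqB m)) z ⇔ InSums m (seqA m) (seqB m) z
  replaceB-sums m s = InSums-reflectʳ {a = seqA m} {seqB m} opposite (seqA-opposite m) (λ j → if-either (s j))

  replaceA-sums : ∀ m s z → InSums m (replaceA m s (seqA m)) (seqB m) z ⇔ InSums m (seqA m) (seqB m) z
  replaceA-sums m s = InSums-reflectˡ {a = seqA m} {b = seqB m} opposite (seqB-opposite m) (λ i → if-either (s i))

  seqA-zero : ∀ m i → toℕ i ≡ 0 → seqA m i ≡ + 1
  seqA-zero m i i≡0 = cong (λ t → + 1 + + (2 ℕ.* t)) i≡0

  seqB-zero : ∀ m i → toℕ i ≡ 0 → seqB m i ≡ + 0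
  seqB-zero m i i≡0 = cong (λ t → + (2 ℕ.* t ℕ.* m)) i≡0

  replaceB-zero : ∀ m s → (∀ i → toℕ i ≡ 0 → s i ≡ false) → ∀ i → toℕ i ≡ 0 → replaceB m s (seqB m) i ≡ + 0
  replaceB-zero m s s₀ i i≡0 = trans (if-cong (s₀ i i≡0)) (seqB-zero m i i≡0)

  replaceA-zero : ∀ m s → (∀ i → toℕ i ≡ 0 → s i ≡ false) → ∀ i → toℕ i ≡ 0 → replaceA m s (seqA m) i ≡ + 1
  replaceA-zero m s s₀ i i≡0 = trans (if-cong (s₀ i i≡0)) (seqA-zero m i i≡0)

open AdmissiblePairs
open import Data.Nat using (_≤_; _*_; _+_)

lemma3p7 : (m : ℕ) → 3 ≤ m → (∃ λ k → m ≡ 2 * k + 1) →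
    Admissible m (seqA m) (seqB m) ×
    ((s : Fin m → Bool) → (∀ i → toℕ i ≡ 0 → s i ≡ false) →
      Admissible m (seqA m) (replaceB m s (seqB m))) ×
    ((s : Fin m → Bool) → (∀ i → toℕ i ≡ 0 → s i ≡ false) →
      Admissible m (replaceA m s (seqA m)) (seqB m))
lemma3p7 ℕ.zero () _
lemma3p7 m@(suc _) _ _ =
    sums⇒Admissible (seqA-zero m) (seqB-zero m) sums ,
    (λ s s₀ → sums⇒Admissible (seqA-zero m) (replaceB-zero m s s₀) (λ z → ⇔-trans (replaceB-sums m s z) (sums z))) ,
    (λ s s₀ → sums⇒Admissible (replaceA-zero m s s₀) (seqB-zero m) (λ z → ⇔-trans (replaceA-sums m s z) (sums z)))
  where
  sums : ∀ z → InSums m (seqA m) (seqB m) z ⇔ In𝒩 (2 * m * m) z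
  sums = InSums-seq⇔In𝒩 m
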